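{- For every $n\ge 3$, the cycle $C_n$ on $n$ vertices satisfies $\gamma^{p}_{I}(C_n)=\left\lceil\frac{n}{2}\right\rceil$.
   Context: All graphs are finite and simple. A perfect Italian dominating function (PID-function) of a graph $G$ is a function $f:V(G)\to\{0,1,2\}$ such that for every vertex $v$ with $f(v)=0$ we have $\sum_{u\in N(v)}f(u)=2$, where $N(v)$ is the open neighborhood of $v$. Its weight is $\sum_{u\in V(G)}f(u)$. The perfect Italian domination number $\gamma^{p}_{I}(G)$ is the minimum weight of a PID-function of $G$. -}

module Defs where

open import Data.Nat using (ℕ; zero; suc; _+_; _≤_; ⌈_/2⌉)
open import Data.Nat.Properties using (_≟_)
open import Data.Fin using (Fin; toℕ)
open import Data.Bool using (Bool; true; false; _∨_; _∧_; if_then_else_)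
open import Data.List using (List; map; allFin)
open import Data.Nat.ListAction using (sum)
open import Data.Product using (Σ; _×_; _,_)
open import Relation.Nullary.Decidable using (⌊_⌋)
open import Relation.Binary.PropositionalEquality using (_≡_)

record Graph (n : ℕ) : Set where
  field
    adj   : Fin n → Fin n → Bool
    sym   : ∀ u v → adj u v ≡ adj v u
    irref : ∀ v → adj v v ≡ false
open Graph public

Σv : ∀ {n} → (Fin n → ℕ) → ℕ
Σv {n} g = sum (map g (allFin n))

weight : ∀ {n} → (Fin n → Fin 3) → ℕ
weight f = Σv (λ u → toℕ (f u))

nbrSum : ∀ {n} → Graph n → (Fin n → Fin 3) → Fin n → ℕ
nbrSum G f v = Σv (λ u → if adj G v u then toℕ (f u) else 0)

IsPID : ∀ {n} → Graph n → (Fin n → Fin 3) → Set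
IsPID {n} G f = ∀ (v : Fin n) → toℕ (f v) ≡ 0 → nbrSum G f v ≡ 2

PerfectItalianDomNumber : ∀ {n} → Graph n → ℕ → Set
PerfectItalianDomNumber {n} G k =
  Σ (Fin n → Fin 3) (λ f → IsPID G f × weight f ≡ k)
  × (∀ (f : Fin n → Fin 3) → IsPID G f → k ≤ weight f)

-- Cycle C_n on vertex set Fin n = {0,…,n-1}: i ~ j iff j = i+1, or i = j+1,
-- or {i,j} = {0, n-1} (i.e. j ≡ i ± 1 mod n).
cycleAdj : (n : ℕ) → Fin n → Fin n → Bool
cycleAdj n i j =
  ⌊ toℕ j ≟ suc (toℕ i) ⌋ ∨ ⌊ toℕ i ≟ suc (toℕ j) ⌋
  ∨ (⌊ toℕ i ≟ 0 ⌋ ∧ ⌊ suc (toℕ j) ≟ n ⌋)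
  ∨ (⌊ toℕ j ≟ 0 ⌋ ∧ ⌊ suc (toℕ i) ≟ n ⌋)

module Submission where

-- If f is a PID-function then every
-- vertex v satisfies 2 ≤ 2·f(v) + Σ_{u∈N(v)} f(u): either f(v) ≥ 1, or
-- f(v) = 0 and the neighbourhood sum is exactly 2.  Summing over v and
-- exchanging the double sum, Σ_v Σ_{u∈N(v)} f(u) = Σ_u f(u)·deg(u), so in a
-- graph of maximum degree Δ we get 2n ≤ (2 + Δ)·w(f).  For the cycle Δ = 2,
-- hence n ≤ 2·w(f) and ⌈n/2⌉ ≤ w(f).
--
-- Label the vertices 0,1,…,n-1 alternately 1,0,1,0,…; this has
-- weight ⌈n/2⌉, and every vertex labelled 0 is odd, so both its neighbours
-- (k-1, and k+1 or 0) are even and labelled 1.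

open import Defs renaming (sym to adj-sym)
open import Data.Nat using (ℕ; zero; suc; pred; _+_; _*_; _≤_; _<_; z≤n; s≤s; ⌈_/2⌉)
open import Data.Nat.Properties
open import Data.Nat.ListAction as List using ()
open import Data.Fin using (Fin; zero; suc; toℕ)
open import Data.Fin.Properties using (toℕ<n)
open import Data.Bool using (Bool; true; false; T; _∨_; _∧_; if_then_else_)
open import Data.Bool.Properties using (T-∨; T-∧)
open import Data.List using (tabulate)
open import Data.List.Properties using (map-tabulate)
open import Data.Product using (_×_; _,_)
open import Data.Product.Function.NonDependent.Propositional using (_×-⇔_)
open import Data.Sum using (_⊎_; inj₁; inj₂)
open import Data.Sum.Function.Propositional using (_⊎-⇔_)
open import Data.Empty using (⊥; ⊥-elim)
open import Function using (_⇔_; Equivalence; mk⇔)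
open import Function.Properties.Equivalence using ()
  renaming (refl to ⇔-refl; sym to ⇔-sym; trans to ⇔-trans)
open import Relation.Nullary using (Dec; yes; no)
open import Relation.Nullary.Decidable using (⌊_⌋; toWitness; fromWitness; isYes≗does)
open import Relation.Binary.PropositionalEquality
open import Algebra.Properties.Semiring.Sum +-*-semiring
  using (sum; sum-cong-≗; ∑-distrib-+; ∑-comm; *-distribˡ-sum; *-distribʳ-sum)

-- The list-based vertex sum Σv of Defs agrees with the library's sum over
-- Fin n, so the library's exchange and distributivity laws apply to it.
Σv≡sum : ∀ {n} (g : Fin n → ℕ) → Σv g ≡ sum g
Σv≡sum {n} g = trans (cong List.sum (map-tabulate (λ i → i) g)) (sum-tabulate n g)
  where
  sum-tabulate : ∀ n (g : Fin n → ℕ) → List.sum (tabulate g) ≡ sum g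
  sum-tabulate zero    g = refl
  sum-tabulate (suc n) g = cong (g zero +_) (sum-tabulate n (λ j → g (suc j)))

sum-mono : ∀ {n} {g h : Fin n → ℕ} → (∀ j → g j ≤ h j) → sum g ≤ sum h
sum-mono {zero}  g≤h = z≤n
sum-mono {suc n} g≤h = +-mono-≤ (g≤h zero) (sum-mono (λ j → g≤h (suc j)))

sum-const : ∀ n c → sum {n} (λ _ → c) ≡ n * c
sum-const zero    c = refl
sum-const (suc n) c = cong (c +_) (sum-const n c)

-- Testing equality of successors is testing equality of their predecessors
-- (true only propositionally: ⌊_⌋ does not compute on open terms).
≟-suc : ∀ a b → ⌊ suc a ≟ suc b ⌋ ≡ ⌊ a ≟ b ⌋
≟-suc a b = trans (isYes≗does (suc a ≟ suc b)) (sym (isYes≗does (a ≟ b)))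

sum-indicator : ∀ {n} (H : ℕ → ℕ) {m} → m < n →
  sum (λ (j : Fin n) → if ⌊ toℕ j ≟ m ⌋ then H (toℕ j) else 0) ≡ H m
sum-indicator {suc n} H {zero} _ = begin
  H 0 + sum {n} (λ _ → 0)  ≡⟨ cong (H 0 +_) (trans (sum-const n 0) (*-zeroʳ n)) ⟩
  H 0 + 0                  ≡⟨ +-identityʳ (H 0) ⟩
  H 0                      ∎
  where open ≡-Reasoning
sum-indicator {suc n} H {suc m} (s≤s m<n) = trans
  (sum-cong-≗ {n} (λ j → cong (λ b → if b then H (suc (toℕ j)) else 0) (≟-suc (toℕ j) m)))
  (sum-indicator (λ x → H (suc x)) m<n)

indicator-split : ∀ (b x y : Bool) c → T b ⇔ (T x ⊎ T y) → (T x → T y → ⊥) →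
  (if b then c else 0) ≡ (if x then c else 0) + (if y then c else 0)
indicator-split true  true  true  c _ exclusive = ⊥-elim (exclusive _ _)
indicator-split true  true  false c _ _ = sym (+-identityʳ c)
indicator-split true  false true  c _ _ = refl
indicator-split true  false false c b⇔ _ with Equivalence.to b⇔ _
... | inj₁ ()
... | inj₂ ()
indicator-split false true  _     c b⇔ _ = ⊥-elim (Equivalence.from b⇔ (inj₁ _))
indicator-split false false true  c b⇔ _ = ⊥-elim (Equivalence.from b⇔ (inj₂ _))
indicator-split false false false c _ _ = refl

indicator-scale : ∀ b x → (if b then x else 0) ≡ x * (if b then 1 else 0)
indicator-scale true  x = sym (*-identityʳ x)
indicator-scale false x = sym (*-zeroʳ x)

degree : ∀ {n} → Graph n → Fin n → ℕ
degree G u = sum (λ v → if adj G u v then 1 else 0)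

pid-local : ∀ {n} (G : Graph n) (f : Fin n → Fin 3) → IsPID G f →
  ∀ v → 2 ≤ 2 * toℕ (f v) + nbrSum G f v
pid-local G f perfect v with toℕ (f v) in fv≡
... | zero  = ≤-reflexive (sym (perfect v fv≡))
... | suc x = ≤-trans (*-monoʳ-≤ 2 (s≤s (z≤n {x}))) (m≤m+n (2 * suc x) _)

-- Weighted handshake identity: every label f(u) is counted once for each
-- neighbour of u, by symmetry of adjacency.
neighbour-sums : ∀ {n} (G : Graph n) (f : Fin n → Fin 3) →
  sum (nbrSum G f) ≡ sum (λ u → toℕ (f u) * degree G u)
neighbour-sums {n} G f = begin
  sum (nbrSum G f)
    ≡⟨ sum-cong-≗ {n} (λ v → Σv≡sum (λ u → if adj G v u then toℕ (f u) else 0)) ⟩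
  sum (λ v → sum (λ u → if adj G v u then toℕ (f u) else 0))
    ≡⟨ ∑-comm (λ v u → if adj G v u then toℕ (f u) else 0) ⟩
  sum (λ u → sum (λ v → if adj G v u then toℕ (f u) else 0))
    ≡⟨ sum-cong-≗ {n} (λ u → sum-cong-≗ {n} (λ v → scaled u v)) ⟩
  sum (λ u → sum (λ v → toℕ (f u) * (if adj G u v then 1 else 0)))
    ≡⟨ sum-cong-≗ {n} (λ u → sym (*-distribˡ-sum (toℕ (f u)) (λ v → if adj G u v then 1 else 0))) ⟩
  sum (λ u → toℕ (f u) * degree G u) ∎
  where
  open ≡-Reasoning
  scaled : ∀ u v → (if adj G v u then toℕ (f u) else 0) ≡ toℕ (f u) * (if adj G u v then 1 else 0)
  scaled u v = trans (indicator-scale (adj G v u) (toℕ (f u)))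
    (cong (λ b → toℕ (f u) * (if b then 1 else 0)) (adj-sym G v u))

pid-weight-bound : ∀ {n} (G : Graph n) (Δ : ℕ) → (∀ u → degree G u ≤ Δ) →
  ∀ f → IsPID G f → 2 * n ≤ (2 + Δ) * weight f
pid-weight-bound {n} G Δ deg≤Δ f perfect = begin
  2 * n                                        ≡⟨ *-comm 2 n ⟩
  n * 2                                        ≡⟨ sum-const n 2 ⟨
  sum {n} (λ _ → 2)                            ≤⟨ sum-mono (pid-local G f perfect) ⟩
  sum (λ v → 2 * label v + nbrSum G f v)       ≡⟨ ∑-distrib-+ (λ v → 2 * label v) (nbrSum G f) ⟩
  sum (λ v → 2 * label v) + sum (nbrSum G f)   ≡⟨ cong₂ _+_ (sym (*-distribˡ-sum 2 label)) (neighbour-sums G f) ⟩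
  2 * W + sum (λ u → label u * degree G u)     ≤⟨ +-monoʳ-≤ (2 * W) (sum-mono (λ u → *-monoʳ-≤ (label u) (deg≤Δ u))) ⟩
  2 * W + sum (λ u → label u * Δ)              ≡⟨ cong (2 * W +_) (*-distribʳ-sum Δ label) ⟨
  2 * W + W * Δ                                ≡⟨ cong (2 * W +_) (*-comm W Δ) ⟩
  2 * W + Δ * W                                ≡⟨ *-distribʳ-+ W 2 Δ ⟨
  (2 + Δ) * W                                  ≡⟨ cong ((2 + Δ) *_) (Σv≡sum label) ⟨
  (2 + Δ) * weight f                           ∎
  where
  open ≤-Reasoning
  label : Fin n → ℕ
  label u = toℕ (f u)
  W = sum label

⌈/2⌉-least : ∀ {n W} → n ≤ 2 * W → ⌈ n /2⌉ ≤ W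
⌈/2⌉-least {n} {W} n≤2W = begin
  ⌈ n /2⌉       ≤⟨ ⌈n/2⌉-mono n≤2W ⟩
  ⌈ 2 * W /2⌉   ≡⟨ cong (λ m → ⌈ W + m /2⌉) (+-identityʳ W) ⟩
  ⌈ W + W /2⌉   ≡⟨ n≡⌈n+n/2⌉ W ⟨
  W             ∎
  where open ≤-Reasoning

-- Successor and predecessor modulo n of a vertex label k < n: the two
-- neighbours of k in the cycle.
next : ℕ → ℕ → ℕ
next n k = if ⌊ suc k ≟ n ⌋ then 0 else suc k

prev : ℕ → ℕ → ℕ
prev n zero    = pred n
prev n (suc k) = k

next<n : ∀ {n k} → k < n → next n k < n
next<n {n} {k} k<n with suc k ≟ n
... | yes _    = ≤-<-trans z≤n k<n
... | no 1+k≢n = ≤∧≢⇒< k<n 1+k≢n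

prev<n : ∀ {n k} → k < n → prev n k < n
prev<n {suc n} {zero}  _   = n<1+n n
prev<n {n}     {suc k} k<n = <-trans (n<1+n k) k<n

-- The two neighbours are distinct once n ≥ 3 (for n = 2 they coincide).
next≢prev : ∀ {n k} → 3 ≤ n → next n k ≢ prev n k
next≢prev {k = zero} (s≤s (s≤s (s≤s _))) ()
next≢prev {n} {suc k} 3≤n with suc (suc k) ≟ n
... | yes 2+k≡n = λ 0≡k → <⇒≢ 3≤n (trans (cong (λ x → suc (suc x)) 0≡k) 2+k≡n)
... | no _      = λ 2+k≡k → m≢1+n+m k (sym 2+k≡k)

CycleEdge : ℕ → ℕ → ℕ → Set
CycleEdge n k m = m ≡ suc k ⊎ k ≡ suc m ⊎ (k ≡ 0 × suc m ≡ n) ⊎ (m ≡ 0 × suc k ≡ n)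

edge⇒neighbour : ∀ {n k m} → m < n → CycleEdge n k m → m ≡ next n k ⊎ m ≡ prev n k
edge⇒neighbour {n} {k} m<n (inj₁ refl) with suc k ≟ n
... | yes refl = ⊥-elim (<-irrefl refl m<n)
... | no _     = inj₁ refl
edge⇒neighbour _ (inj₂ (inj₁ refl)) = inj₂ refl
edge⇒neighbour _ (inj₂ (inj₂ (inj₁ (refl , refl)))) = inj₂ refl
edge⇒neighbour {n} {k} _ (inj₂ (inj₂ (inj₂ (refl , 1+k≡n)))) with suc k ≟ n
... | yes _    = inj₁ refl
... | no 1+k≢n = ⊥-elim (1+k≢n 1+k≡n)

neighbour⇒edge : ∀ {n k m} → k < n → m ≡ next n k ⊎ m ≡ prev n k → CycleEdge n k m
neighbour⇒edge {n} {k} _ (inj₁ refl) with suc k ≟ n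
... | yes 1+k≡n = inj₂ (inj₂ (inj₂ (refl , 1+k≡n)))
... | no _      = inj₁ refl
neighbour⇒edge {suc n} {zero}  _ (inj₂ refl) = inj₂ (inj₂ (inj₁ (refl , refl)))
neighbour⇒edge {n}     {suc k} _ (inj₂ refl) = inj₂ (inj₁ refl)

T-⌊⌋ : ∀ {P : Set} (p? : Dec P) → T ⌊ p? ⌋ ⇔ P
T-⌊⌋ p? = mk⇔ toWitness fromWitness

T-clauses : ∀ a b c d e f →
  T (a ∨ b ∨ c ∧ d ∨ e ∧ f) ⇔ (T a ⊎ T b ⊎ (T c × T d) ⊎ (T e × T f))
T-clauses a b c d e f =
  ⇔-trans (T-∨ {a}) (⇔-refl ⊎-⇔ ⇔-trans (T-∨ {b}) (⇔-refl ⊎-⇔ ⇔-trans (T-∨ {c ∧ d}) (T-∧ ⊎-⇔ T-∧)))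

cycleAdj-reflects : ∀ {n} (i j : Fin n) → T (cycleAdj n i j) ⇔ CycleEdge n (toℕ i) (toℕ j)
cycleAdj-reflects {n} i j = ⇔-trans (T-clauses ⌊ d₁ ⌋ ⌊ d₂ ⌋ ⌊ d₃ ⌋ ⌊ d₄ ⌋ ⌊ d₅ ⌋ ⌊ d₆ ⌋)
  (T-⌊⌋ d₁ ⊎-⇔ T-⌊⌋ d₂ ⊎-⇔ (T-⌊⌋ d₃ ×-⇔ T-⌊⌋ d₄) ⊎-⇔ (T-⌊⌋ d₅ ×-⇔ T-⌊⌋ d₆))
  where
  d₁ = toℕ j ≟ suc (toℕ i)
  d₂ = toℕ i ≟ suc (toℕ j)
  d₃ = toℕ i ≟ 0
  d₄ = suc (toℕ j) ≟ n
  d₅ = toℕ j ≟ 0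
  d₆ = suc (toℕ i) ≟ n

cycleAdj⇔neighbour : ∀ {n} (i j : Fin n) →
  T (cycleAdj n i j) ⇔ (toℕ j ≡ next n (toℕ i) ⊎ toℕ j ≡ prev n (toℕ i))
cycleAdj⇔neighbour i j = ⇔-trans (cycleAdj-reflects i j)
  (mk⇔ (edge⇒neighbour (toℕ<n j)) (neighbour⇒edge (toℕ<n i)))

cycle-neighbour-sum : ∀ {n} → 3 ≤ n → (H : ℕ → ℕ) (i : Fin n) →
  sum (λ j → if cycleAdj n i j then H (toℕ j) else 0) ≡ H (next n (toℕ i)) + H (prev n (toℕ i))
cycle-neighbour-sum {n} 3≤n H i = begin
  sum (λ j → if cycleAdj n i j then H (toℕ j) else 0)
    ≡⟨ sum-cong-≗ {n} (λ j → indicator-split _ _ _ (H (toℕ j)) (reflects j) exclusive) ⟩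
  sum (λ j → at-next j + at-prev j)
    ≡⟨ ∑-distrib-+ at-next at-prev ⟩
  sum at-next + sum at-prev
    ≡⟨ cong₂ _+_ (sum-indicator H (next<n k<n)) (sum-indicator H (prev<n k<n)) ⟩
  H (next n k) + H (prev n k) ∎
  where
  open ≡-Reasoning
  k = toℕ i
  k<n = toℕ<n i
  at-next at-prev : Fin n → ℕ
  at-next j = if ⌊ toℕ j ≟ next n k ⌋ then H (toℕ j) else 0
  at-prev j = if ⌊ toℕ j ≟ prev n k ⌋ then H (toℕ j) else 0
  reflects : ∀ j → T (cycleAdj n i j) ⇔ (T ⌊ toℕ j ≟ next n k ⌋ ⊎ T ⌊ toℕ j ≟ prev n k ⌋)
  reflects j = ⇔-trans (cycleAdj⇔neighbour i j) (⇔-sym (T-⌊⌋ _ ⊎-⇔ T-⌊⌋ _))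
  exclusive : ∀ {m} → T ⌊ m ≟ next n k ⌋ → T ⌊ m ≟ prev n k ⌋ → ⊥
  exclusive is-next is-prev = next≢prev 3≤n (trans (sym (toWitness is-next)) (toWitness is-prev))

alternating : ℕ → Fin 3
alternating zero          = suc zero
alternating (suc zero)    = zero
alternating (suc (suc k)) = alternating k

-- Its weight on 0,…,n-1 is the number of even labels, ⌈n/2⌉.
alternating-weight : ∀ n → sum (λ (j : Fin n) → toℕ (alternating (toℕ j))) ≡ ⌈ n /2⌉
alternating-weight zero          = refl
alternating-weight (suc zero)    = refl
alternating-weight (suc (suc n)) = cong suc (alternating-weight n)

odd-predecessor : ∀ k → toℕ (alternating (suc k)) ≡ 0 → toℕ (alternating k) ≡ 1
odd-predecessor zero          _ = refl
odd-predecessor (suc zero)    ()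
odd-predecessor (suc (suc k)) = odd-predecessor k

-- Both cycle-neighbours of a vertex labelled 0 are labelled 1: its
-- predecessor is even, and its successor is either even or the vertex 0.
alternating-perfect : ∀ n k → toℕ (alternating k) ≡ 0 →
  toℕ (alternating (next n k)) + toℕ (alternating (prev n k)) ≡ 2
alternating-perfect n (suc k) odd with suc (suc k) ≟ n
... | yes _ = cong suc (odd-predecessor k odd)
... | no _  = cong₂ _+_ (odd-predecessor k odd) (odd-predecessor k odd)

theorem2p5 : (n : ℕ) → (h : 3 ≤ n) → (G : Graph n)
    → (∀ u v → adj G u v ≡ cycleAdj n u v)
    → PerfectItalianDomNumber G ⌈ n /2⌉
theorem2p5 n 3≤n G G-is-cycle = (f₀ , f₀-perfect , f₀-weight) , minimal
  where
  neighbours : ∀ (H : ℕ → ℕ) v →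
    sum (λ u → if adj G v u then H (toℕ u) else 0) ≡ H (next n (toℕ v)) + H (prev n (toℕ v))
  neighbours H v = trans (sum-cong-≗ {n} (λ u → cong (λ b → if b then H (toℕ u) else 0) (G-is-cycle v u)))
    (cycle-neighbour-sum 3≤n H v)

  f₀ : Fin n → Fin 3
  f₀ v = alternating (toℕ v)

  f₀-perfect : IsPID G f₀
  f₀-perfect v odd = trans (Σv≡sum (λ u → if adj G v u then toℕ (f₀ u) else 0))
    (trans (neighbours (λ k → toℕ (alternating k)) v) (alternating-perfect n (toℕ v) odd))

  f₀-weight : weight f₀ ≡ ⌈ n /2⌉
  f₀-weight = trans (Σv≡sum (λ u → toℕ (f₀ u))) (alternating-weight n)

  -- Cₙ is 2-regular, so the general bound gives 2n ≤ 4·w(f).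
  minimal : ∀ f → IsPID G f → ⌈ n /2⌉ ≤ weight f
  minimal f perfect = ⌈/2⌉-least (*-cancelˡ-≤ 2 (subst (2 * n ≤_) (*-assoc 2 2 (weight f))
    (pid-weight-bound G 2 (λ u → ≤-reflexive (neighbours (λ _ → 1) u)) f perfect)))
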